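{- Let $n\ge 2$ and let $g_1,g_2\in\hat S_n$ be glides with offsets $k_1$ and $k_2$ respectively. Then $$g_2g_1=\rho^{k_2}(g_1)\,\rho^{ -k_1}(g_2).$$
   Context: The affine symmetric group $\hat S_n$ is generated by $s_0,s_1,\dots,s_{n-1}$ (indices taken modulo $n$) subject to $s_i^2=1$, $s_is_js_i=s_js_is_j$ if $i-j\equiv\pm1 \pmod n$, and $s_is_j=s_js_i$ if $i-j\not\equiv 0,\pm1\pmod n$. Let $\rho:\hat S_n\to\hat S_n$ be the automorphism with $\rho(s_i)=s_{i+1}$ for all $i$. Let $\phi:\hat S_n\to S_n$ be the homomorphism with $\phi(s_i)=(i\ \ i+1)$ for $1\le i\le n-1$ and $\phi(s_0)=(1\ \ n)$. An element $g\in\hat S_n$ is a glide if $\phi(g)$ is the permutation $j\mapsto j+k$ (values read modulo $n$ in $\{1,\dots,n\}$), i.e. $1,2,\dots,n-k,n-k+1,\dots,n\mapsto 1+k,2+k,\dots,n,1,\dots,k$, for some $k\in\{0,1,\dots,n-1\}$; this $k$ is the offset of the glide. -}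

module Defs where

open import Data.Nat using (ℕ; zero; suc; _+_; _≤_; _%_)
open import Data.Nat.DivMod using (m%n<n)
open import Data.Fin using (Fin; toℕ; fromℕ<; _≟_)
open import Data.List using (List; []; _∷_; _++_; map; foldr)
open import Data.Sum using (_⊎_)
open import Data.Product using (_×_)
open import Function using (id; _∘_)
open import Relation.Nullary using (¬_; yes; no)
open import Relation.Binary.PropositionalEquality using (_≡_)

-- Indices of generators s_0 … s_{n-1} are elements of Fin n.
-- Points of {1,…,n} are encoded 0-indexed as Fin n (point p ↦ p - 1).

sucF : ∀ {n} → Fin n → Fin n
sucF {suc m} i = fromℕ< (m%n<n (suc (toℕ i)) (suc m))

predF : ∀ {n} → Fin n → Fin n
predF {suc m} i = fromℕ< (m%n<n (toℕ i + m) (suc m))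

addF : ∀ {n} → ℕ → Fin n → Fin n
addF {suc m} k j = fromℕ< (m%n<n (toℕ j + k) (suc m))

iter : ∀ {A : Set} → ℕ → (A → A) → A → A
iter zero    f = id
iter (suc k) f = f ∘ iter k f

-- Words in the generators: [i₁, …, iᵣ] stands for s_{i₁} s_{i₂} ⋯ s_{iᵣ}.
Word : ℕ → Set
Word n = List (Fin n)

Adj : ∀ {n} → Fin n → Fin n → Set
Adj i j = (j ≡ sucF i) ⊎ (i ≡ sucF j)

-- Elements of Ŝ_n are words modulo _≈_.
-- (Braid relations are imposed only for n ≥ 3: for n = 2 the affine
--  symmetric group is the infinite dihedral group.)
infix 4 _≈_
data _≈_ {n : ℕ} : Word n → Word n → Set where
  ≈-refl  : ∀ {u} → u ≈ u
  ≈-sym   : ∀ {u v} → u ≈ v → v ≈ u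
  ≈-trans : ∀ {u v w} → u ≈ v → v ≈ w → u ≈ w
  ≈-cong  : ∀ {u v} (a b : Word n) → u ≈ v → a ++ u ++ b ≈ a ++ v ++ b
  involution : ∀ i → (i ∷ i ∷ []) ≈ []
  braid   : 3 ≤ n → ∀ i j → Adj i j → (i ∷ j ∷ i ∷ []) ≈ (j ∷ i ∷ j ∷ [])
  commute : ∀ i j → ¬ (i ≡ j) → ¬ Adj i j → (i ∷ j ∷ []) ≈ (j ∷ i ∷ [])

-- ρ(s_i) = s_{i+1};  ρ^k and ρ^{-k} act letterwise on words.
ρ^ : ∀ {n} → ℕ → Word n → Word n
ρ^ k = map (iter k sucF)

ρ^- : ∀ {n} → ℕ → Word n → Word n
ρ^- k = map (iter k predF)

swap : ∀ {n} → Fin n → Fin n → Fin n → Fin n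
swap a b x with x ≟ a
... | yes _ = b
... | no _ with x ≟ b
...   | yes _ = a
...   | no _  = x

-- φ(s_i) = (i  i+1) for 1 ≤ i ≤ n-1 and φ(s_0) = (1  n); in 0-indexed points,
-- φ(s_i) swaps (i - 1 mod n) and i.
φgen : ∀ {n} → Fin n → Fin n → Fin n
φgen i = swap (predF i) i

φ : ∀ {n} → Word n → Fin n → Fin n
φ = foldr (λ i f → φgen i ∘ f) id

IsGlide : ∀ {n} → Word n → ℕ → Set
IsGlide {n} g k = (k Data.Nat.< n) × (∀ j → φ g j ≡ addF k j)

-- The affine symmetric group acts on ℤ in window notation: s_i becomes the n-periodic
-- bijection σ i exchanging x and x + 1 for every x in the residue class predF i, a word w
-- acts as the composite ⟦ w ⟧, and φ w is ⟦ w ⟧ read modulo n.  Hence a glide of offset k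
-- sends x to x + k plus a multiple of n, and ρ corresponds to conjugating by x ↦ x + 1;
-- with these two facts both sides of the identity act on ℤ as the same bijection.
--
-- It remains to see that the action is faithful.  Stripping descents (residues i with
-- f (x + 1) < f x for x in predF i) one at a time gives a canonical word; this terminates
-- because the energy Σ (f c - c)² over one period drops by 2 (f x - f (x + 1)).  By
-- induction on the energy, the commutation and braid relations show that stripping any
-- descent first gives an equivalent word, and therefore canon ⟦ w ⟧ ≈ w.

module Submission where

open import Defs
open import Data.Nat as ℕ using (ℕ; zero; suc; s≤s; z≤n; _≤_)
import Data.Nat.Properties as ℕP
import Data.Nat.DivMod as ℕD
open import Data.Integer as ℤ using (ℤ; +_; -[1+_]; +[1+_]; 0ℤ; 1ℤ; ∣_∣)
import Data.Integer.Properties as ℤP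
open import Data.Integer.DivMod using (_/ℕ_; n%ℕd<d; a≡a%ℕn+[a/ℕn]*n)
open import Data.Integer.Tactic.RingSolver using (solve-∀)
import Data.Nat.Tactic.RingSolver as ℕSolver
open import Algebra.Properties.CommutativeMonoid.Sum ℕP.+-0-commutativeMonoid using (sum; sum-cong-≗)
open import Algebra.Properties.CommutativeSemigroup ℤP.+-commutativeSemigroup using (xy∙z≈xz∙y)
open import Algebra.Properties.AbelianGroup ℤP.+-0-abelianGroup using (∙-cancelˡ; ∙-cancelʳ)
open import Data.Fin as F using (Fin; toℕ; fromℕ<)
import Data.Fin.Properties as FP
open import Data.Product using (_,_; proj₁; proj₂; ∃)
open import Data.Sum using (_⊎_; inj₁; inj₂; [_,_]) renaming (swap to ⊎-swap)
open import Data.Empty using (⊥-elim)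
open import Relation.Nullary using (¬_; yes; no; Dec; does)
open import Relation.Binary.PropositionalEquality using (_≡_; _≢_; refl; sym; trans; cong; cong₂; subst; subst₂; module ≡-Reasoning)
open import Data.List using ([]; _∷_; _++_; _∷ʳ_; foldr; find; allFin)
open import Data.List.Properties using (map-∘; map-cong; map-id; ++-assoc; ++-identityʳ)
open import Data.List.Membership.Propositional using (_∈_)
open import Data.List.Membership.Propositional.Properties using (∈-allFin)
open import Data.List.Relation.Unary.Any using (here; there)
open import Data.List.Reverse using (Reverse; reverseView; []; _∶_∶ʳ_)
open import Data.Maybe using (Maybe; just; nothing; maybe)
open import Data.Maybe.Properties using (just-injective)
open import Relation.Unary using (Pred; Decidable)
open import Relation.Binary.Bundles using (Setoid)
import Relation.Binary.Reasoning.Setoid as SetoidReasoning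
open import Function using (id; _∘_)

module _ where
  open import Data.Nat using (_+_)
  open import Data.Fin using (zero; suc)

  +-trade : ∀ {e e' a a' s} → e' + a ≡ e + a' → a' + s ≡ a → e' + s ≡ e
  +-trade {e} {e'} {a} {a'} {s} e'+a≡e+a' a'+s≡a = ℕP.+-cancelʳ-≡ a' _ _ (begin
      e' + s + a'        ≡⟨ ℕP.+-assoc e' s a' ⟩
      e' + (s + a')      ≡⟨ cong (_+_ e') (trans (ℕP.+-comm s a') a'+s≡a) ⟩
      e' + a             ≡⟨ e'+a≡e+a' ⟩
      e + a'             ∎)
    where open ≡-Reasoning

  sum-differ-at : ∀ {k} (h h' : Fin k → ℕ) a → (∀ c → c ≢ a → h' c ≡ h c) → sum h' + h a ≡ sum h + h' a
  sum-differ-at h h' zero agree = begin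
      h' zero + sum (h' ∘ suc) + h zero   ≡⟨ cong (λ s → h' zero + s + h zero) (sum-cong-≗ (λ c → agree (suc c) λ ())) ⟩
      h' zero + sum (h ∘ suc) + h zero    ≡⟨ exchange (h' zero) (sum (h ∘ suc)) (h zero) ⟩
      h zero + sum (h ∘ suc) + h' zero    ∎
    where
    open ≡-Reasoning
    exchange : ∀ a s b → a + s + b ≡ b + s + a
    exchange = ℕSolver.solve-∀
  sum-differ-at h h' (suc a) agree = begin
      h' zero + sum (h' ∘ suc) + h (suc a)     ≡⟨ ℕP.+-assoc (h' zero) _ _ ⟩
      h' zero + (sum (h' ∘ suc) + h (suc a))   ≡⟨ cong₂ _+_ (agree zero λ ()) (sum-differ-at (h ∘ suc) (h' ∘ suc) a (λ c c≢a → agree (suc c) (c≢a ∘ FP.suc-injective))) ⟩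
      h zero + (sum (h ∘ suc) + h' (suc a))    ≡⟨ ℕP.+-assoc (h zero) _ _ ⟨
      h zero + sum (h ∘ suc) + h' (suc a)      ∎
    where
    open ≡-Reasoning

  sum-differ-at₂ : ∀ {k} (h h' : Fin k → ℕ) {a b} → a ≢ b → (∀ c → c ≢ a → c ≢ b → h' c ≡ h c) →
                sum h' + (h a + h b) ≡ sum h + (h' a + h' b)
  sum-differ-at₂ h h' {zero} {zero} a≢b agree = ⊥-elim (a≢b refl)
  sum-differ-at₂ h h' {zero} {suc b} a≢b agree = begin
      h' zero + sum (h' ∘ suc) + (h zero + h (suc b))   ≡⟨ interchange (h' zero) _ (h zero) _ ⟩
      h' zero + h zero + (sum (h' ∘ suc) + h (suc b))   ≡⟨ cong (_+_ (h' zero + h zero)) (sum-differ-at (h ∘ suc) (h' ∘ suc) b (λ c c≢b → agree (suc c) (λ ()) (c≢b ∘ FP.suc-injective))) ⟩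
      h' zero + h zero + (sum (h ∘ suc) + h' (suc b))   ≡⟨ interchange′ (h' zero) (h zero) _ _ ⟩
      h zero + sum (h ∘ suc) + (h' zero + h' (suc b))   ∎
    where
    open ≡-Reasoning
    interchange : ∀ a s b t → a + s + (b + t) ≡ a + b + (s + t)
    interchange = ℕSolver.solve-∀
    interchange′ : ∀ a b s t → a + b + (s + t) ≡ b + s + (a + t)
    interchange′ = ℕSolver.solve-∀
  sum-differ-at₂ h h' {suc a} {zero} a≢b agree = begin
      h' zero + sum (h' ∘ suc) + (h (suc a) + h zero)   ≡⟨ interchange (h' zero) _ _ (h zero) ⟩
      h' zero + h zero + (sum (h' ∘ suc) + h (suc a))   ≡⟨ cong (_+_ (h' zero + h zero)) (sum-differ-at (h ∘ suc) (h' ∘ suc) a (λ c c≢a → agree (suc c) (c≢a ∘ FP.suc-injective) (λ ()))) ⟩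
      h' zero + h zero + (sum (h ∘ suc) + h' (suc a))   ≡⟨ interchange′ (h' zero) (h zero) _ _ ⟩
      h zero + sum (h ∘ suc) + (h' (suc a) + h' zero)   ∎
    where
    open ≡-Reasoning
    interchange : ∀ a s t b → a + s + (t + b) ≡ a + b + (s + t)
    interchange = ℕSolver.solve-∀
    interchange′ : ∀ a b s t → a + b + (s + t) ≡ b + s + (t + a)
    interchange′ = ℕSolver.solve-∀
  sum-differ-at₂ h h' {suc a} {suc b} a≢b agree = begin
      h' zero + sum (h' ∘ suc) + (h (suc a) + h (suc b))   ≡⟨ ℕP.+-assoc (h' zero) _ _ ⟩
      h' zero + (sum (h' ∘ suc) + (h (suc a) + h (suc b))) ≡⟨ cong₂ _+_ (agree zero (λ ()) (λ ())) (sum-differ-at₂ (h ∘ suc) (h' ∘ suc) (a≢b ∘ cong suc) (λ c c≢a c≢b → agree (suc c) (c≢a ∘ FP.suc-injective) (c≢b ∘ FP.suc-injective))) ⟩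
      h zero + (sum (h ∘ suc) + (h' (suc a) + h' (suc b))) ≡⟨ ℕP.+-assoc (h zero) _ _ ⟨
      h zero + sum (h ∘ suc) + (h' (suc a) + h' (suc b))   ∎
    where
    open ≡-Reasoning

module _ {a p} {A : Set a} {P : Pred A p} where

  find-just : (P? : Decidable P) → ∀ xs {x} → find P? xs ≡ just x → P x
  find-just P? (y ∷ ys) eq with P? y
  ... | yes p = subst P (just-injective eq) p
  ... | no _ = find-just P? ys eq

  find-nothing : (P? : Decidable P) → ∀ xs {x} → find P? xs ≡ nothing → x ∈ xs → ¬ P x
  find-nothing P? (y ∷ ys) eq x∈ with P? y
  find-nothing P? (y ∷ ys) () x∈ | yes _
  find-nothing P? (y ∷ ys) eq (here refl) | no ¬p = ¬p
  find-nothing P? (y ∷ ys) eq (there x∈) | no _ = find-nothing P? ys eq x∈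

  find-none : (P? : Decidable P) → (∀ x → ¬ P x) → ∀ xs → find P? xs ≡ nothing
  find-none P? ¬P [] = refl
  find-none P? ¬P (y ∷ ys) with P? y
  ... | yes p = ⊥-elim (¬P y p)
  ... | no _ = find-none P? ¬P ys

find-cong : ∀ {a p q} {A : Set a} {P : Pred A p} {Q : Pred A q} (P? : Decidable P) (Q? : Decidable Q) → (∀ x → does (P? x) ≡ does (Q? x)) → ∀ xs → find P? xs ≡ find Q? xs
find-cong P? Q? same [] = refl
find-cong P? Q? same (y ∷ ys) with P? y | Q? y | same y
... | yes _ | yes _ | _ = refl
... | no _ | no _ | _ = find-cong P? Q? same ys

iter-inverse : ∀ {A : Set} {f g : A → A} → (∀ x → f (g x) ≡ x) → ∀ k x → iter k f (iter k g x) ≡ x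
iter-inverse f∘g zero x = refl
iter-inverse {f = f} {g} f∘g (suc k) x = begin
    f (iter k f (g (iter k g x)))   ≡⟨ cong (f ∘ iter k f) (iter-commute k x) ⟩
    f (iter k f (iter k g (g x)))   ≡⟨ cong f (iter-inverse f∘g k (g x)) ⟩
    f (g x)                         ≡⟨ f∘g x ⟩
    x                               ∎
  where
  open ≡-Reasoning
  iter-commute : ∀ k x → g (iter k g x) ≡ iter k g (g x)
  iter-commute zero x = refl
  iter-commute (suc k) x = cong g (iter-commute k x)

module _ where
  open import Data.Integer using (_+_; _*_; _-_; -_)

  sq : ℤ → ℕ
  sq z = ∣ z ∣ ℕ.* ∣ z ∣

  +sq : ∀ z → + sq z ≡ z * z
  +sq (+ k) = ℤP.pos-* k k
  +sq -[1+ k ] = refl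

  <⇒+[1+] : ∀ {a b} → a ℤ.< b → ∃ λ t → b ≡ a + +[1+ t ]
  <⇒+[1+] {a} {b} a<b with positive (b - a) (subst (ℤ._< b - a) (ℤP.+-inverseʳ a) (ℤP.+-monoˡ-< (- a) a<b))
    where
    positive : ∀ d → 0ℤ ℤ.< d → ∃ λ t → d ≡ +[1+ t ]
    positive +[1+ t ] _ = t , refl
    positive (+ zero) (ℤ.+<+ ())
  ... | t , b-a≡ = t , trans (split a b) (cong (_+_ a) b-a≡)
    where
    split : ∀ a b → b ≡ a + (b - a)
    split = solve-∀

  squares-exchange : ∀ y v t → sq (v - y) ℕ.+ sq (v + +[1+ t ] - (y + 1ℤ)) ℕ.+ 2 ℕ.* suc t
                             ≡ sq (v + +[1+ t ] - y) ℕ.+ sq (v - (y + 1ℤ))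
  squares-exchange y v t = ℤP.+-injective (begin
      + (sq (v - y) ℕ.+ sq (u - (y + 1ℤ)) ℕ.+ 2 ℕ.* suc t)           ≡⟨ ℤP.pos-+ (sq (v - y) ℕ.+ sq (u - (y + 1ℤ))) _ ⟩
      + (sq (v - y) ℕ.+ sq (u - (y + 1ℤ))) + + (2 ℕ.* suc t)         ≡⟨ cong₂ _+_ (ℤP.pos-+ (sq (v - y)) _) (ℤP.pos-* 2 (suc t)) ⟩
      + sq (v - y) + + sq (u - (y + 1ℤ)) + + 2 * + suc t             ≡⟨ cong₂ (λ a b → a + b + + 2 * + suc t) (+sq (v - y)) (+sq (u - (y + 1ℤ))) ⟩
      (v - y) * (v - y) + (u - (y + 1ℤ)) * (u - (y + 1ℤ)) + + 2 * + suc t   ≡⟨ identity y v (+ suc t) ⟩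
      (u - y) * (u - y) + (v - (y + 1ℤ)) * (v - (y + 1ℤ))            ≡⟨ cong₂ _+_ (+sq (u - y)) (+sq (v - (y + 1ℤ))) ⟨
      + sq (u - y) + + sq (v - (y + 1ℤ))                              ≡⟨ ℤP.pos-+ (sq (u - y)) _ ⟨
      + (sq (u - y) ℕ.+ sq (v - (y + 1ℤ)))                            ∎)
    where
    open ≡-Reasoning
    u = v + +[1+ t ]
    identity : ∀ y v s → (v - y) * (v - y) + (v + s - (y + 1ℤ)) * (v + s - (y + 1ℤ)) + + 2 * s
                       ≡ (v + s - y) * (v + s - y) + (v - (y + 1ℤ)) * (v - (y + 1ℤ))
    identity = solve-∀

module _ {n : ℕ} where

  swap-left : ∀ (a b : Fin n) → swap a b a ≡ b
  swap-left a b with a F.≟ a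
  ... | yes _ = refl
  ... | no a≢a = ⊥-elim (a≢a refl)

  swap-right : ∀ (a b : Fin n) → a ≢ b → swap a b b ≡ a
  swap-right a b a≢b with b F.≟ a
  ... | yes b≡a = ⊥-elim (a≢b (sym b≡a))
  ... | no _ with b F.≟ b
  ...   | yes _ = refl
  ...   | no b≢b = ⊥-elim (b≢b refl)

  swap-other : ∀ (a b x : Fin n) → x ≢ a → x ≢ b → swap a b x ≡ x
  swap-other a b x x≢a x≢b with x F.≟ a
  ... | yes x≡a = ⊥-elim (x≢a x≡a)
  ... | no _ with x F.≟ b
  ...   | yes x≡b = ⊥-elim (x≢b x≡b)
  ...   | no _ = refl

  ≡⇒≈ : {u v : Word n} → u ≡ v → u ≈ v
  ≡⇒≈ refl = ≈-refl

  ≈-setoid : Setoid _ _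
  ≈-setoid = record
    { Carrier = Word n
    ; _≈_ = _≈_
    ; isEquivalence = record { refl = ≈-refl ; sym = ≈-sym ; trans = ≈-trans }
    }

  ≈-++ʳ : {u u' : Word n} (w : Word n) → u ≈ u' → u ++ w ≈ u' ++ w
  ≈-++ʳ w = ≈-cong [] w

  ≈-++ˡ : {u u' : Word n} (w : Word n) → u ≈ u' → w ++ u ≈ w ++ u'
  ≈-++ˡ {u} {u'} w eq = subst₂ _≈_ (cong (w ++_) (++-identityʳ u)) (cong (w ++_) (++-identityʳ u')) (≈-cong w [] eq)

  ≈-∷ʳ-++ : {u v : Word n} (c : Fin n) (w : Word n) → u ≈ v ∷ʳ c → u ++ w ≈ v ++ c ∷ w
  ≈-∷ʳ-++ {u} {v} c w eq = ≈-trans (≈-++ʳ w eq) (≡⇒≈ (++-assoc v (c ∷ []) w))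

module Residues (m : ℕ) where
  open import Data.Integer using (_+_; _*_; _-_; -_)

  n : ℕ
  n = suc (suc m)

  N : ℤ
  N = + n

  private
    move-multiple : ∀ {a b} c → a ≡ b + c * N → b ≡ a + (- c) * N
    move-multiple {a} {b} c eq = trans (lemma b c N) (cong (λ z → z + (- c) * N) (sym eq))
      where
      lemma : ∀ b c N → b ≡ b + c * N + (- c) * N
      lemma = solve-∀

    collect-multiples : ∀ {a b} q q' → a + q * N ≡ b + q' * N → a ≡ b + (q' - q) * N
    collect-multiples {a} {b} q q' eq = begin
        a                    ≡⟨ cancel a q N ⟩
        a + q * N - q * N    ≡⟨ cong (_- q * N) eq ⟩
        b + q' * N - q * N   ≡⟨ regroup b q q' N ⟩
        b + (q' - q) * N     ∎
      where
      open ≡-Reasoning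
      cancel : ∀ a q N → a ≡ a + q * N - q * N
      cancel = solve-∀
      regroup : ∀ b q q' N → b + q' * N - q * N ≡ b + (q' - q) * N
      regroup = solve-∀

    nonzero-multiple-too-big : ∀ r r' k → r ℕ.< n → + r ≢ + r' + +[1+ k ] * N
    nonzero-multiple-too-big r r' k r<n eq = ℕP.<⇒≱ r<n (begin
        n                     ≤⟨ ℕP.m≤m+n n (k ℕ.* n) ⟩
        suc k ℕ.* n           ≤⟨ ℕP.m≤n+m _ r' ⟩
        r' ℕ.+ suc k ℕ.* n    ≡⟨ ℤP.+-injective (trans (ℤP.pos-+ r' _) (trans (cong (_+_ (+ r')) (ℤP.pos-* (suc k) n)) (sym eq))) ⟩
        r                     ∎)
      where open ℕP.≤-Reasoning

    multiple-between-remainders : ∀ {r r'} d → r ℕ.< n → r' ℕ.< n → + r ≡ + r' + d * N → d ≡ 0ℤ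
    multiple-between-remainders (+ zero)   _   _    _  = refl
    multiple-between-remainders +[1+ k ]  r<n _    eq = ⊥-elim (nonzero-multiple-too-big _ _ k r<n eq)
    multiple-between-remainders -[1+ k ]  _   r'<n eq = ⊥-elim (nonzero-multiple-too-big _ _ k r'<n (move-multiple -[1+ k ] eq))

  remainder-unique : ∀ {r r'} q q' → r ℕ.< n → r' ℕ.< n → + r + q * N ≡ + r' + q' * N → r ≡ r'
  remainder-unique {r} {r'} q q' r<n r'<n eq = ℤP.+-injective (begin
      + r                    ≡⟨ difference ⟩
      + r' + (q' - q) * N    ≡⟨ cong (λ d → + r' + d * N) (multiple-between-remainders (q' - q) r<n r'<n difference) ⟩
      + r' + 0ℤ * N          ≡⟨ ℤP.+-identityʳ (+ r') ⟩
      + r'                   ∎)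
    where
    open ≡-Reasoning
    difference : + r ≡ + r' + (q' - q) * N
    difference = collect-multiples {+ r} {+ r'} q q' eq

  residue : ℤ → Fin n
  residue x = fromℕ< (n%ℕd<d x n)

  residue-decomposition : ∀ x → x ≡ + toℕ (residue x) + (x /ℕ n) * N
  residue-decomposition x = trans (a≡a%ℕn+[a/ℕn]*n x n) (cong (λ r → + r + (x /ℕ n) * N) (sym (FP.toℕ-fromℕ< (n%ℕd<d x n))))

  residue-unique : ∀ {x} (r : Fin n) q → x ≡ + toℕ r + q * N → residue x ≡ r
  residue-unique {x} r q eq = FP.toℕ-injective
    (remainder-unique (x /ℕ n) q (FP.toℕ<n (residue x)) (FP.toℕ<n r) (trans (sym (residue-decomposition x)) eq))

  residue-toℕ : ∀ r → residue (+ toℕ r) ≡ r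
  residue-toℕ r = residue-unique r 0ℤ (sym (ℤP.+-identityʳ (+ toℕ r)))

  residue-periodic : ∀ x q → residue (x + q * N) ≡ residue x
  residue-periodic x q = residue-unique (residue x) (x /ℕ n + q) (begin
      x + q * N                                         ≡⟨ cong (_+ q * N) (residue-decomposition x) ⟩
      + toℕ (residue x) + (x /ℕ n) * N + q * N          ≡⟨ regroup (+ toℕ (residue x)) (x /ℕ n) q N ⟩
      + toℕ (residue x) + (x /ℕ n + q) * N              ∎)
    where
    open ≡-Reasoning
    regroup : ∀ r p q N → r + p * N + q * N ≡ r + (p + q) * N
    regroup = solve-∀

  residue-≡ : ∀ x y → residue x ≡ residue y → ∃ λ q → y ≡ x + q * N
  residue-≡ x y eq = y /ℕ n - x /ℕ n , (begin
      y                                                 ≡⟨ residue-decomposition y ⟩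
      + toℕ (residue y) + (y /ℕ n) * N                  ≡⟨ cong (λ r → + toℕ r + (y /ℕ n) * N) (sym eq) ⟩
      + toℕ (residue x) + (y /ℕ n) * N                  ≡⟨ regroup (+ toℕ (residue x)) (x /ℕ n) (y /ℕ n) N ⟩
      + toℕ (residue x) + (x /ℕ n) * N + (y /ℕ n - x /ℕ n) * N  ≡⟨ cong (_+ (y /ℕ n - x /ℕ n) * N) (sym (residue-decomposition x)) ⟩
      x + (y /ℕ n - x /ℕ n) * N                         ∎)
    where
    open ≡-Reasoning
    regroup : ∀ r p q N → r + q * N ≡ r + p * N + (q - p) * N
    regroup = solve-∀

  residue-+ : ∀ x k → residue (x + + k) ≡ addF k (residue x)
  residue-+ x k = residue-unique (addF k (residue x)) (+ (s ℕD./ n) + x /ℕ n) (begin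
      x + + k                                            ≡⟨ cong (_+ + k) (residue-decomposition x) ⟩
      + r + (x /ℕ n) * N + + k                           ≡⟨ regroup (+ r) (x /ℕ n) (+ k) N ⟩
      + s + (x /ℕ n) * N                                 ≡⟨ cong (λ z → z + (x /ℕ n) * N) s-decomposition ⟩
      + toℕ (addF k (residue x)) + + (s ℕD./ n) * N + (x /ℕ n) * N  ≡⟨ collect (+ toℕ (addF k (residue x))) (+ (s ℕD./ n)) (x /ℕ n) N ⟩
      + toℕ (addF k (residue x)) + (+ (s ℕD./ n) + x /ℕ n) * N      ∎)
    where
    open ≡-Reasoning
    r = toℕ (residue x)
    s = r ℕ.+ k
    s-decomposition : + s ≡ + toℕ (addF k (residue x)) + + (s ℕD./ n) * N
    s-decomposition = begin
      + s                                        ≡⟨ cong +_ (ℕD.m≡m%n+[m/n]*n s n) ⟩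
      + (s ℕD.% n ℕ.+ s ℕD./ n ℕ.* n)            ≡⟨ ℤP.pos-+ (s ℕD.% n) _ ⟩
      + (s ℕD.% n) + + (s ℕD./ n ℕ.* n)          ≡⟨ cong₂ (λ a b → + a + b) (sym (FP.toℕ-fromℕ< (ℕD.m%n<n s n))) (ℤP.pos-* (s ℕD./ n) n) ⟩
      + toℕ (addF k (residue x)) + + (s ℕD./ n) * N  ∎
    regroup : ∀ r p k N → r + p * N + k ≡ (r + k) + p * N
    regroup = solve-∀
    collect : ∀ a b c N → a + b * N + c * N ≡ a + (b + c) * N
    collect = solve-∀

  residue-suc : ∀ x → residue (x + 1ℤ) ≡ sucF (residue x)
  residue-suc x = trans (residue-+ x 1)
    (FP.toℕ-injective (trans (FP.toℕ-fromℕ< _) (trans (cong (ℕD._% n) (ℕP.+-comm (toℕ (residue x)) 1)) (sym (FP.toℕ-fromℕ< _)))))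

  residue-pred : ∀ x → residue (x - 1ℤ) ≡ predF (residue x)
  residue-pred x = begin
      residue (x - 1ℤ)                                ≡⟨ cong residue (regroup x (+ suc m)) ⟩
      residue (x + + suc m + (- 1ℤ) * N)              ≡⟨ residue-periodic (x + + suc m) (- 1ℤ) ⟩
      residue (x + + suc m)                           ≡⟨ residue-+ x (suc m) ⟩
      predF (residue x)                               ∎
    where
    open ≡-Reasoning
    regroup : ∀ x a → x - 1ℤ ≡ (x + a) + (- 1ℤ) * (1ℤ + a)
    regroup = solve-∀

  residue-injective-near : ∀ x {a b} → a ℕ.< n → b ℕ.< n → residue (x + + a) ≡ residue (x + + b) → a ≡ b
  residue-injective-near x {a} {b} a<n b<n eq = sym (remainder-unique 0ℤ q b<n a<n (begin
      + b + 0ℤ * N           ≡⟨ ℤP.+-identityʳ (+ b) ⟩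
      + b                    ≡⟨ ∙-cancelˡ x (+ b) (+ a + q * N) (trans x+b≡ (ℤP.+-assoc x (+ a) (q * N))) ⟩
      + a + q * N            ∎))
    where
    open ≡-Reasoning
    q = proj₁ (residue-≡ (x + + a) (x + + b) eq)
    x+b≡ = proj₂ (residue-≡ (x + + a) (x + + b) eq)

  sucF-predF : ∀ i → sucF (predF i) ≡ i
  sucF-predF i = begin
      sucF (predF i)                      ≡⟨ cong (sucF ∘ predF) (sym (residue-toℕ i)) ⟩
      sucF (predF (residue x))            ≡⟨ cong sucF (sym (residue-pred x)) ⟩
      sucF (residue (x - 1ℤ))             ≡⟨ sym (residue-suc (x - 1ℤ)) ⟩
      residue (x - 1ℤ + 1ℤ)               ≡⟨ cong residue (cancel x) ⟩
      residue x                           ≡⟨ residue-toℕ i ⟩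
      i                                   ∎
    where
    open ≡-Reasoning
    x = + toℕ i
    cancel : ∀ x → x - 1ℤ + 1ℤ ≡ x
    cancel = solve-∀

  predF-sucF : ∀ i → predF (sucF i) ≡ i
  predF-sucF i = begin
      predF (sucF i)                      ≡⟨ cong (predF ∘ sucF) (sym (residue-toℕ i)) ⟩
      predF (sucF (residue x))            ≡⟨ cong predF (sym (residue-suc x)) ⟩
      predF (residue (x + 1ℤ))            ≡⟨ sym (residue-pred (x + 1ℤ)) ⟩
      residue (x + 1ℤ - 1ℤ)               ≡⟨ cong residue (cancel x) ⟩
      residue x                           ≡⟨ residue-toℕ i ⟩
      i                                   ∎
    where
    open ≡-Reasoning
    x = + toℕ i
    cancel : ∀ x → x + 1ℤ - 1ℤ ≡ x
    cancel = solve-∀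

  sucF-injective : ∀ {i j} → sucF i ≡ sucF j → i ≡ j
  sucF-injective {i} {j} eq = trans (sym (predF-sucF i)) (trans (cong predF eq) (predF-sucF j))

  predF-injective : ∀ {i j} → predF i ≡ predF j → i ≡ j
  predF-injective {i} {j} eq = trans (sym (sucF-predF i)) (trans (cong sucF eq) (sucF-predF j))

  private
    residue-around : ∀ i a → residue (+ toℕ i - 1ℤ + + a) ≡ iter a sucF (predF i)
    residue-around i zero = begin
        residue (y + + 0)      ≡⟨ cong residue (ℤP.+-identityʳ y) ⟩
        residue (x - 1ℤ)       ≡⟨ residue-pred x ⟩
        predF (residue x)      ≡⟨ cong predF (residue-toℕ i) ⟩
        predF i                ∎
      where
      open ≡-Reasoning
      x = + toℕ i
      y = x - 1ℤ
    residue-around i (suc a) = begin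
        residue (y + + suc a)                ≡⟨ cong residue (regroup y (+ a)) ⟩
        residue (y + + a + 1ℤ)               ≡⟨ residue-suc (y + + a) ⟩
        sucF (residue (y + + a))             ≡⟨ cong sucF (residue-around i a) ⟩
        sucF (iter a sucF (predF i))         ∎
      where
      open ≡-Reasoning
      y = + toℕ i - 1ℤ
      regroup : ∀ y a → y + (1ℤ + a) ≡ y + a + 1ℤ
      regroup = solve-∀

  predF≢ : ∀ i → predF i ≢ i
  predF≢ i eq = 0≢1 (residue-injective-near (+ toℕ i - 1ℤ) (s≤s z≤n) (s≤s (s≤s z≤n))
    (trans (residue-around i 0) (trans eq (trans (sym (sucF-predF i)) (sym (residue-around i 1))))))
    where
    0≢1 : 0 ≢ 1
    0≢1 ()

  sucF≢ : ∀ i → sucF i ≢ i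
  sucF≢ i eq = predF≢ (sucF i) (trans (predF-sucF i) (sym eq))

  sucF≢predF : 3 ℕ.≤ n → ∀ i → sucF i ≢ predF i
  sucF≢predF 3≤n i eq = 0≢2 (residue-injective-near (+ toℕ i - 1ℤ) (s≤s z≤n) 3≤n
    (trans (residue-around i 0) (trans (sym eq) (trans (cong sucF (sym (sucF-predF i))) (sym (residue-around i 2))))))
    where
    0≢2 : 0 ≢ 2
    0≢2 ()

module Action (m : ℕ) where
  open import Data.Integer using (_+_; _*_; _-_; -_)
  open Residues m

  σ : Fin n → ℤ → ℤ
  σ i x with residue x F.≟ predF i
  ... | yes _ = x + 1ℤ
  ... | no _ with residue x F.≟ i
  ...   | yes _ = x - 1ℤ
  ...   | no _ = x

  data Position (i : Fin n) (x : ℤ) : Set where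
    below : residue x ≡ predF i → Position i x
    above : residue x ≡ i → Position i x
    away  : residue x ≢ predF i → residue x ≢ i → Position i x

  position : ∀ i x → Position i x
  position i x with residue x F.≟ predF i
  ... | yes e = below e
  ... | no ≢predF with residue x F.≟ i
  ...   | yes e = above e
  ...   | no ≢i = away ≢predF ≢i

  σ-below : ∀ i x → residue x ≡ predF i → σ i x ≡ x + 1ℤ
  σ-below i x e with residue x F.≟ predF i
  ... | yes _ = refl
  ... | no ≢predF = ⊥-elim (≢predF e)

  σ-above : ∀ i x → residue x ≡ i → σ i x ≡ x - 1ℤ
  σ-above i x e with residue x F.≟ predF i
  ... | yes e' = ⊥-elim (predF≢ i (trans (sym e') e))
  ... | no _ with residue x F.≟ i
  ...   | yes _ = refl
  ...   | no ≢i = ⊥-elim (≢i e)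

  σ-away : ∀ i x → residue x ≢ predF i → residue x ≢ i → σ i x ≡ x
  σ-away i x ≢predF ≢i with residue x F.≟ predF i
  ... | yes e = ⊥-elim (≢predF e)
  ... | no _ with residue x F.≟ i
  ...   | yes e = ⊥-elim (≢i e)
  ...   | no _ = refl

  residue-succ-below : ∀ {i} x → residue x ≡ predF i → residue (x + 1ℤ) ≡ i
  residue-succ-below {i} x e = trans (residue-suc x) (trans (cong sucF e) (sucF-predF i))

  residue-pred-above : ∀ {i} x → residue x ≡ i → residue (x - 1ℤ) ≡ predF i
  residue-pred-above {i} x e = trans (residue-pred x) (cong predF e)

  residue-σ : ∀ i x → residue (σ i x) ≡ φgen i (residue x)
  residue-σ i x with position i x
  ... | below e = begin
      residue (σ i x)                   ≡⟨ cong residue (σ-below i x e) ⟩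
      residue (x + 1ℤ)                  ≡⟨ residue-succ-below x e ⟩
      i                                 ≡⟨ sym (swap-left (predF i) i) ⟩
      φgen i (predF i)                  ≡⟨ cong (φgen i) (sym e) ⟩
      φgen i (residue x)                ∎
    where open ≡-Reasoning
  ... | above e = begin
      residue (σ i x)                   ≡⟨ cong residue (σ-above i x e) ⟩
      residue (x - 1ℤ)                  ≡⟨ residue-pred-above x e ⟩
      predF i                           ≡⟨ sym (swap-right (predF i) i (predF≢ i)) ⟩
      φgen i i                          ≡⟨ cong (φgen i) (sym e) ⟩
      φgen i (residue x)                ∎
    where open ≡-Reasoning
  ... | away ≢predF ≢i = trans (cong residue (σ-away i x ≢predF ≢i)) (sym (swap-other (predF i) i (residue x) ≢predF ≢i))

  Periodic : (ℤ → ℤ) → Set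
  Periodic f = ∀ x q → f (x + q * N) ≡ f x + q * N

  σ-periodic : ∀ i → Periodic (σ i)
  σ-periodic i x q with position i x
  ... | below e = begin
      σ i (x + q * N)          ≡⟨ σ-below i (x + q * N) (trans (residue-periodic x q) e) ⟩
      x + q * N + 1ℤ           ≡⟨ xy∙z≈xz∙y x (q * N) 1ℤ ⟩
      x + 1ℤ + q * N           ≡⟨ cong (_+ q * N) (sym (σ-below i x e)) ⟩
      σ i x + q * N            ∎
    where open ≡-Reasoning
  ... | above e = begin
      σ i (x + q * N)          ≡⟨ σ-above i (x + q * N) (trans (residue-periodic x q) e) ⟩
      x + q * N - 1ℤ           ≡⟨ xy∙z≈xz∙y x (q * N) (- 1ℤ) ⟩
      x - 1ℤ + q * N           ≡⟨ cong (_+ q * N) (sym (σ-above i x e)) ⟩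
      σ i x + q * N            ∎
    where open ≡-Reasoning
  ... | away ≢predF ≢i = begin
      σ i (x + q * N)          ≡⟨ σ-away i (x + q * N) (≢predF ∘ trans (sym (residue-periodic x q))) (≢i ∘ trans (sym (residue-periodic x q))) ⟩
      x + q * N                ≡⟨ cong (_+ q * N) (sym (σ-away i x ≢predF ≢i)) ⟩
      σ i x + q * N            ∎
    where open ≡-Reasoning

  σ-involutive : ∀ i x → σ i (σ i x) ≡ x
  σ-involutive i x with position i x
  ... | below e = begin
      σ i (σ i x)              ≡⟨ cong (σ i) (σ-below i x e) ⟩
      σ i (x + 1ℤ)             ≡⟨ σ-above i (x + 1ℤ) (residue-succ-below x e) ⟩
      x + 1ℤ - 1ℤ              ≡⟨ cancel x ⟩
      x                        ∎
    where
    open ≡-Reasoning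
    cancel : ∀ x → x + 1ℤ - 1ℤ ≡ x
    cancel = solve-∀
  ... | above e = begin
      σ i (σ i x)              ≡⟨ cong (σ i) (σ-above i x e) ⟩
      σ i (x - 1ℤ)             ≡⟨ σ-below i (x - 1ℤ) (residue-pred-above x e) ⟩
      x - 1ℤ + 1ℤ              ≡⟨ cancel x ⟩
      x                        ∎
    where
    open ≡-Reasoning
    cancel : ∀ x → x - 1ℤ + 1ℤ ≡ x
    cancel = solve-∀
  ... | away ≢predF ≢i = trans (cong (σ i) (σ-away i x ≢predF ≢i)) (σ-away i x ≢predF ≢i)

  σ-sucF : ∀ i x → σ (sucF i) (x + 1ℤ) ≡ σ i x + 1ℤ
  σ-sucF i x with position i x
  ... | below e = trans (σ-below (sucF i) (x + 1ℤ) (trans (residue-succ-below x e) (sym (predF-sucF i))))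
                        (cong (_+ 1ℤ) (sym (σ-below i x e)))
  ... | above e = begin
      σ (sucF i) (x + 1ℤ)      ≡⟨ σ-above (sucF i) (x + 1ℤ) (trans (residue-suc x) (cong sucF e)) ⟩
      x + 1ℤ - 1ℤ              ≡⟨ xy∙z≈xz∙y x 1ℤ (- 1ℤ) ⟩
      x - 1ℤ + 1ℤ              ≡⟨ cong (_+ 1ℤ) (sym (σ-above i x e)) ⟩
      σ i x + 1ℤ               ∎
    where open ≡-Reasoning
  ... | away ≢predF ≢i = trans (σ-away (sucF i) (x + 1ℤ) ≢i-below ≢i-above) (cong (_+ 1ℤ) (sym (σ-away i x ≢predF ≢i)))
    where
    ≢i-below : residue (x + 1ℤ) ≢ predF (sucF i)
    ≢i-below e = ≢predF (begin
      residue x                      ≡⟨ sym (predF-sucF (residue x)) ⟩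
      predF (sucF (residue x))       ≡⟨ cong predF (sym (residue-suc x)) ⟩
      predF (residue (x + 1ℤ))       ≡⟨ cong predF (trans e (predF-sucF i)) ⟩
      predF i                        ∎)
      where open ≡-Reasoning
    ≢i-above : residue (x + 1ℤ) ≢ sucF i
    ≢i-above e = ≢i (sucF-injective (trans (sym (residue-suc x)) e))

  σ-iter-sucF : ∀ k i x → σ (iter k sucF i) (x + + k) ≡ σ i x + + k
  σ-iter-sucF zero i x = trans (cong (σ i) (ℤP.+-identityʳ x)) (sym (ℤP.+-identityʳ (σ i x)))
  σ-iter-sucF (suc k) i x = begin
      σ (sucF (iter k sucF i)) (x + + suc k)      ≡⟨ cong (σ (sucF (iter k sucF i))) (add-suc x (+ k)) ⟨
      σ (sucF (iter k sucF i)) (x + + k + 1ℤ)     ≡⟨ σ-sucF (iter k sucF i) (x + + k) ⟩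
      σ (iter k sucF i) (x + + k) + 1ℤ            ≡⟨ cong (_+ 1ℤ) (σ-iter-sucF k i x) ⟩
      σ i x + + k + 1ℤ                            ≡⟨ add-suc (σ i x) (+ k) ⟩
      σ i x + + suc k                             ∎
    where
    open ≡-Reasoning
    add-suc : ∀ a k → a + k + 1ℤ ≡ a + (1ℤ + k)
    add-suc = solve-∀

  ⟦_⟧ : Word n → ℤ → ℤ
  ⟦_⟧ = foldr (λ i f → σ i ∘ f) id

  ⟦⟧-++ : ∀ u v x → ⟦ u ++ v ⟧ x ≡ ⟦ u ⟧ (⟦ v ⟧ x)
  ⟦⟧-++ [] v x = refl
  ⟦⟧-++ (i ∷ u) v x = cong (σ i) (⟦⟧-++ u v x)

  residue-⟦⟧ : ∀ w x → residue (⟦ w ⟧ x) ≡ φ w (residue x)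
  residue-⟦⟧ [] x = refl
  residue-⟦⟧ (i ∷ w) x = trans (residue-σ i (⟦ w ⟧ x)) (cong (φgen i) (residue-⟦⟧ w x))

  ⟦⟧-periodic : ∀ w → Periodic ⟦ w ⟧
  ⟦⟧-periodic [] x q = refl
  ⟦⟧-periodic (i ∷ w) x q = trans (cong (σ i) (⟦⟧-periodic w x q)) (σ-periodic i (⟦ w ⟧ x) q)

  ⟦⟧-ρ^ : ∀ k w x → ⟦ ρ^ k w ⟧ (x + + k) ≡ ⟦ w ⟧ x + + k
  ⟦⟧-ρ^ k [] x = refl
  ⟦⟧-ρ^ k (i ∷ w) x = trans (cong (σ (iter k sucF i)) (⟦⟧-ρ^ k w x)) (σ-iter-sucF k i (⟦ w ⟧ x))

  ⟦⟧-ρ^- : ∀ k w x → ⟦ ρ^- k w ⟧ x + + k ≡ ⟦ w ⟧ (x + + k)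
  ⟦⟧-ρ^- k w x = begin
      ⟦ ρ^- k w ⟧ x + + k                 ≡⟨ ⟦⟧-ρ^ k (ρ^- k w) x ⟨
      ⟦ ρ^ k (ρ^- k w) ⟧ (x + + k)        ≡⟨ cong (λ v → ⟦ v ⟧ (x + + k)) ρ^-ρ^- ⟩
      ⟦ w ⟧ (x + + k)                     ∎
    where
    open ≡-Reasoning
    ρ^-ρ^- : ρ^ k (ρ^- k w) ≡ w
    ρ^-ρ^- = trans (sym (map-∘ w)) (trans (map-cong (iter-inverse sucF-predF k) w) (map-id w))

  ⟦⟧-glide : ∀ g k → IsGlide g k → ∀ x → ∃ λ c → ⟦ g ⟧ x ≡ x + + k + c * N
  ⟦⟧-glide g k (_ , φg≡shift) x = residue-≡ (x + + k) (⟦ g ⟧ x) (begin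
      residue (x + + k)           ≡⟨ residue-+ x k ⟩
      addF k (residue x)          ≡⟨ φg≡shift (residue x) ⟨
      φ g (residue x)             ≡⟨ residue-⟦⟧ g x ⟨
      residue (⟦ g ⟧ x)           ∎)
    where open ≡-Reasoning

  ⟦⟧-glide-exchange : ∀ g₁ g₂ k₁ k₂ → IsGlide g₁ k₁ → IsGlide g₂ k₂ →
                      ∀ x → ⟦ g₂ ++ g₁ ⟧ x ≡ ⟦ ρ^ k₂ g₁ ++ ρ^- k₁ g₂ ⟧ x
  ⟦⟧-glide-exchange g₁ g₂ k₁ k₂ glide₁ glide₂ x = begin
      ⟦ g₂ ++ g₁ ⟧ x                                 ≡⟨ ⟦⟧-++ g₂ g₁ x ⟩
      ⟦ g₂ ⟧ (⟦ g₁ ⟧ x)                              ≡⟨ cong ⟦ g₂ ⟧ g₁x ⟩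
      ⟦ g₂ ⟧ (x + + k₁ + b * N)                      ≡⟨ ⟦⟧-periodic g₂ (x + + k₁) b ⟩
      ⟦ g₂ ⟧ (x + + k₁) + b * N                      ≡⟨ cong (_+ b * N) g₂x ⟩
      x + + k₁ + + k₂ + a * N + b * N                ≡⟨ regroup x (+ k₁) (+ k₂) a b N ⟩
      x + + k₁ + b * N + a * N + + k₂                ≡⟨ cong (λ z → z + a * N + + k₂) g₁x ⟨
      ⟦ g₁ ⟧ x + a * N + + k₂                        ≡⟨ cong (_+ + k₂) (⟦⟧-periodic g₁ x a) ⟨
      ⟦ g₁ ⟧ (x + a * N) + + k₂                      ≡⟨ ⟦⟧-ρ^ k₂ g₁ (x + a * N) ⟨
      ⟦ ρ^ k₂ g₁ ⟧ (x + a * N + + k₂)                ≡⟨ cong ⟦ ρ^ k₂ g₁ ⟧ ρ^-g₂x ⟨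
      ⟦ ρ^ k₂ g₁ ⟧ (⟦ ρ^- k₁ g₂ ⟧ x)                 ≡⟨ ⟦⟧-++ (ρ^ k₂ g₁) (ρ^- k₁ g₂) x ⟨
      ⟦ ρ^ k₂ g₁ ++ ρ^- k₁ g₂ ⟧ x                    ∎
    where
    open ≡-Reasoning
    regroup : ∀ x k₁ k₂ a b N → x + k₁ + k₂ + a * N + b * N ≡ x + k₁ + b * N + a * N + k₂
    regroup = solve-∀
    shuffle : ∀ x k₁ k₂ a N → x + k₁ + k₂ + a * N ≡ x + a * N + k₂ + k₁
    shuffle = solve-∀
    b = proj₁ (⟦⟧-glide g₁ k₁ glide₁ x)
    g₁x = proj₂ (⟦⟧-glide g₁ k₁ glide₁ x)
    a = proj₁ (⟦⟧-glide g₂ k₂ glide₂ (x + + k₁))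
    g₂x = proj₂ (⟦⟧-glide g₂ k₂ glide₂ (x + + k₁))
    ρ^-g₂x : ⟦ ρ^- k₁ g₂ ⟧ x ≡ x + a * N + + k₂
    ρ^-g₂x = ∙-cancelʳ (+ k₁) _ _ (trans (⟦⟧-ρ^- k₁ g₂ x) (trans g₂x (shuffle x (+ k₁) (+ k₂) a N)))

module Descents (m : ℕ) where
  open import Data.Integer using (_+_; _*_; _-_; -_)
  open Residues m
  open Action m

  infixl 5 _⋆_
  _⋆_ : (ℤ → ℤ) → Fin n → ℤ → ℤ
  (f ⋆ i) x = f (σ i x)

  ⋆-periodic : ∀ {f} i → Periodic f → Periodic (f ⋆ i)
  ⋆-periodic {f} i f-periodic x q = trans (cong f (σ-periodic i x q)) (f-periodic (σ i x) q)

  ⟦⟧-∷ʳ : ∀ w i x → ⟦ w ∷ʳ i ⟧ x ≡ (⟦ w ⟧ ⋆ i) x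
  ⟦⟧-∷ʳ w i x = ⟦⟧-++ w (i ∷ []) x

  corner : Fin n → ℤ
  corner i = + toℕ (predF i)

  residue-corner : ∀ i → residue (corner i) ≡ predF i
  residue-corner i = residue-toℕ (predF i)

  Descent : (ℤ → ℤ) → Fin n → Set
  Descent f i = f (corner i + 1ℤ) ℤ.< f (corner i)

  descent? : ∀ f i → Dec (Descent f i)
  descent? f i = f (corner i + 1ℤ) ℤP.<? f (corner i)

  descent-transport : ∀ {f} x y → Periodic f → residue x ≡ residue y → f (x + 1ℤ) ℤ.< f x → f (y + 1ℤ) ℤ.< f y
  descent-transport {f} x y f-periodic eq desc = subst₂ ℤ._<_ (sym f[y+1]≡) (sym f[y]≡) (ℤP.+-monoˡ-< (q * N) desc)
    where
    q = proj₁ (residue-≡ x y eq)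
    y≡ = proj₂ (residue-≡ x y eq)
    f[y]≡ : f y ≡ f x + q * N
    f[y]≡ = trans (cong f y≡) (f-periodic x q)
    f[y+1]≡ : f (y + 1ℤ) ≡ f (x + 1ℤ) + q * N
    f[y+1]≡ = trans (cong (λ z → f (z + 1ℤ)) y≡) (trans (cong f (xy∙z≈xz∙y x (q * N) 1ℤ)) (f-periodic (x + 1ℤ) q))

  descent⇒at : ∀ {f i} x → Periodic f → residue x ≡ predF i → Descent f i → f (x + 1ℤ) ℤ.< f x
  descent⇒at {i = i} x f-periodic eq = descent-transport (corner i) x f-periodic (trans (residue-corner i) (sym eq))

  at⇒descent : ∀ {f i} x → Periodic f → residue x ≡ predF i → f (x + 1ℤ) ℤ.< f x → Descent f i
  at⇒descent {i = i} x f-periodic eq = descent-transport x (corner i) f-periodic (trans eq (sym (residue-corner i)))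

  displacement : (ℤ → ℤ) → Fin n → ℤ
  displacement f c = f (+ toℕ c) - + toℕ c

  displacement-at : ∀ {f c} x → Periodic f → residue x ≡ c → displacement f c ≡ f x - x
  displacement-at {f} {c} x f-periodic eq = begin
      f ĉ - ĉ                          ≡⟨ cancel (f ĉ) ĉ (q * N) ⟩
      f ĉ + q * N - (ĉ + q * N)        ≡⟨ cong (_- (ĉ + q * N)) (f-periodic ĉ q) ⟨
      f (ĉ + q * N) - (ĉ + q * N)      ≡⟨ cong (λ z → f z - z) x≡ ⟨
      f x - x                          ∎
    where
    open ≡-Reasoning
    ĉ = + toℕ c
    q = proj₁ (residue-≡ ĉ x (trans (residue-toℕ c) (sym eq)))
    x≡ = proj₂ (residue-≡ ĉ x (trans (residue-toℕ c) (sym eq)))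
    cancel : ∀ a b c → a - b ≡ a + c - (b + c)
    cancel = solve-∀

  energy : (ℤ → ℤ) → ℕ
  energy f = sum (λ c → sq (displacement f c))

  energy-descent : ∀ {f i} → Periodic f → Descent f i → energy (f ⋆ i) ℕ.< energy f
  energy-descent {f} {i} f-periodic desc = subst (energy (f ⋆ i) ℕ.<_) energy≡ (ℕP.m<m+n (energy (f ⋆ i)) ℕ.z<s)
    where
    t = proj₁ (<⇒+[1+] desc)
    fy≡ = proj₂ (<⇒+[1+] desc)
    y = corner i
    v = f (y + 1ℤ)
    h h' : Fin n → ℕ
    h c = sq (displacement f c)
    h' c = sq (displacement (f ⋆ i) c)
    residue-y+1 : residue (y + 1ℤ) ≡ i
    residue-y+1 = residue-succ-below y (residue-corner i)
    agree : ∀ c → c ≢ predF i → c ≢ i → h' c ≡ h c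
    agree c c≢predF c≢i = cong (λ z → sq (f z - + toℕ c))
      (σ-away i (+ toℕ c) (c≢predF ∘ trans (sym (residue-toℕ c))) (c≢i ∘ trans (sym (residue-toℕ c))))
    h-predF : h (predF i) ≡ sq (v + +[1+ t ] - y)
    h-predF = cong (λ z → sq (z - y)) fy≡
    h-i : h i ≡ sq (v - (y + 1ℤ))
    h-i = cong sq (displacement-at {f} (y + 1ℤ) f-periodic residue-y+1)
    h'-predF : h' (predF i) ≡ sq (v - y)
    h'-predF = cong (λ z → sq (f z - y)) (σ-below i y (residue-corner i))
    h'-i : h' i ≡ sq (v + +[1+ t ] - (y + 1ℤ))
    h'-i = cong sq (trans (displacement-at {f ⋆ i} (y + 1ℤ) (⋆-periodic {f} i f-periodic) residue-y+1)
                          (cong (_- (y + 1ℤ)) (trans (cong f (trans (σ-above i (y + 1ℤ) residue-y+1) (cancel y))) fy≡)))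
      where
      cancel : ∀ y → y + 1ℤ - 1ℤ ≡ y
      cancel = solve-∀
    energy≡ : energy (f ⋆ i) ℕ.+ 2 ℕ.* suc t ≡ energy f
    energy≡ = +-trade (sum-differ-at₂ h h' (predF≢ i) agree) exchange
      where
      open ≡-Reasoning
      exchange : h' (predF i) ℕ.+ h' i ℕ.+ 2 ℕ.* suc t ≡ h (predF i) ℕ.+ h i
      exchange = begin
        h' (predF i) ℕ.+ h' i ℕ.+ 2 ℕ.* suc t                                   ≡⟨ cong₂ (λ a b → a ℕ.+ b ℕ.+ 2 ℕ.* suc t) h'-predF h'-i ⟩
        sq (v - y) ℕ.+ sq (v + +[1+ t ] - (y + 1ℤ)) ℕ.+ 2 ℕ.* suc t            ≡⟨ squares-exchange y v t ⟩
        sq (v + +[1+ t ] - y) ℕ.+ sq (v - (y + 1ℤ))                            ≡⟨ cong₂ ℕ._+_ h-predF h-i ⟨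
        h (predF i) ℕ.+ h i                                                     ∎

  σ-fixes-far : ∀ {a b} → a ≢ b → ¬ Adj a b → ∀ x → residue x ≡ predF a ⊎ residue x ≡ a → σ b x ≡ x
  σ-fixes-far {a} {b} a≢b a≁b x (inj₁ e) =
    σ-away b x (λ e' → a≢b (predF-injective (trans (sym e) e')))
               (λ e' → a≁b (inj₂ (trans (sym (sucF-predF a)) (cong sucF (trans (sym e) e')))))
  σ-fixes-far {a} {b} a≢b a≁b x (inj₂ e) =
    σ-away b x (λ e' → a≁b (inj₁ (trans (sym (sucF-predF b)) (cong sucF (trans (sym e') e)))))
               (λ e' → a≢b (trans (sym e) e'))

  descent-far : ∀ {f a b} → a ≢ b → ¬ Adj a b → Descent f a → Descent (f ⋆ b) a
  descent-far {f} {a} a≢b a≁b = subst₂ ℤ._<_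
    (cong f (sym (σ-fixes-far a≢b a≁b (corner a + 1ℤ) (inj₂ (residue-succ-below (corner a) (residue-corner a))))))
    (cong f (sym (σ-fixes-far a≢b a≁b (corner a) (inj₁ (residue-corner a)))))

  σ-commute : ∀ {a b} → a ≢ b → ¬ Adj a b → ∀ x → σ a (σ b x) ≡ σ b (σ a x)
  σ-commute {a} {b} a≢b a≁b x = by-position (position a x)
    where
    b-fixed = σ-fixes-far a≢b a≁b
    a-fixed = σ-fixes-far (a≢b ∘ sym) (a≁b ∘ ⊎-swap)

    a-fixes-σb : residue x ≢ predF a → residue x ≢ a → Position b x → σ a (σ b x) ≡ σ b x
    a-fixes-σb _ _ (below e) = a-fixed (σ b x) (inj₂ (trans (cong residue (σ-below b x e)) (residue-succ-below x e)))
    a-fixes-σb _ _ (above e) = a-fixed (σ b x) (inj₁ (trans (cong residue (σ-above b x e)) (residue-pred-above x e)))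
    a-fixes-σb ≢predF ≢a (away ≢predF' ≢b) =
      trans (cong (σ a) (σ-away b x ≢predF' ≢b)) (trans (σ-away a x ≢predF ≢a) (sym (σ-away b x ≢predF' ≢b)))

    by-position : Position a x → σ a (σ b x) ≡ σ b (σ a x)
    by-position (below e) = trans (cong (σ a) (b-fixed x (inj₁ e)))
      (sym (b-fixed (σ a x) (inj₂ (trans (cong residue (σ-below a x e)) (residue-succ-below x e)))))
    by-position (above e) = trans (cong (σ a) (b-fixed x (inj₂ e)))
      (sym (b-fixed (σ a x) (inj₁ (trans (cong residue (σ-above a x e)) (residue-pred-above x e)))))
    by-position (away ≢predF ≢a) =
      trans (a-fixes-σb ≢predF ≢a (position b x)) (cong (σ b) (sym (σ-away a x ≢predF ≢a)))

  adjacent-descents⇒3≤n : ∀ {f a} → Periodic f → Descent f a → Descent f (sucF a) → 3 ℕ.≤ n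
  adjacent-descents⇒3≤n {f} {a} f-periodic desc-a desc-b with 3 ℕ.≤? n
  ... | yes 3≤n = 3≤n
  ... | no 3≰n = ⊥-elim (ℤP.<-irrefl refl (ℤP.≤-<-trans (ℤP.i≤i+j (f x₀) N) (subst (ℤ._< f x₀) f[x₀+2]≡ (ℤP.<-trans desc-b' desc-a))))
    where
    x₀ = corner a
    desc-b' : f (x₀ + 1ℤ + 1ℤ) ℤ.< f (x₀ + 1ℤ)
    desc-b' = descent⇒at {f} {sucF a} (x₀ + 1ℤ) f-periodic (trans (residue-succ-below x₀ (residue-corner a)) (sym (predF-sucF a))) desc-b
    N≡2 : N ≡ + 2
    N≡2 = cong +_ (ℕP.≤-antisym (ℕP.≮⇒≥ 3≰n) (s≤s (s≤s z≤n)))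
    x₀+2≡ : x₀ + 1ℤ + 1ℤ ≡ x₀ + 1ℤ * N
    x₀+2≡ = trans (two x₀) (cong (λ z → x₀ + 1ℤ * z) (sym N≡2))
      where
      two : ∀ x → x + 1ℤ + 1ℤ ≡ x + 1ℤ * + 2
      two = solve-∀
    f[x₀+2]≡ : f (x₀ + 1ℤ + 1ℤ) ≡ f x₀ + N
    f[x₀+2]≡ = trans (cong f x₀+2≡) (trans (f-periodic x₀ 1ℤ) (cong (_+_ (f x₀)) (ℤP.*-identityˡ N)))

  module Adjacent (a : Fin n) (3≤n : 3 ℕ.≤ n) where
    private
      b = sucF a

      predF≢b : predF a ≢ b
      predF≢b e = sucF≢predF 3≤n a (sym e)

      σb-below : ∀ x → residue x ≡ a → σ b x ≡ x + 1ℤ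
      σb-below x e = σ-below b x (trans e (sym (predF-sucF a)))

      σb-fixes : ∀ x → residue x ≡ predF a → σ b x ≡ x
      σb-fixes x e = σ-away b x (λ e' → predF≢ a (trans (sym e) (trans e' (predF-sucF a)))) (λ e' → predF≢b (trans (sym e) e'))

      σa-fixes : ∀ x → residue x ≡ b → σ a x ≡ x
      σa-fixes x e = σ-away a x (λ e' → predF≢b (trans (sym e') e)) (λ e' → sucF≢ a (trans (sym e) e'))

    σ-braid : ∀ x → σ a (σ b (σ a x)) ≡ σ b (σ a (σ b x))
    σ-braid x with position a x
    ... | below e = begin
        σ a (σ b (σ a x))          ≡⟨ cong (σ a ∘ σ b) (σ-below a x e) ⟩
        σ a (σ b (x + 1ℤ))         ≡⟨ cong (σ a) (σb-below (x + 1ℤ) r₁) ⟩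
        σ a (x + 1ℤ + 1ℤ)          ≡⟨ σa-fixes (x + 1ℤ + 1ℤ) r₂ ⟩
        x + 1ℤ + 1ℤ                ≡⟨ σb-below (x + 1ℤ) r₁ ⟨
        σ b (x + 1ℤ)               ≡⟨ cong (σ b) (σ-below a x e) ⟨
        σ b (σ a x)                ≡⟨ cong (σ b ∘ σ a) (σb-fixes x e) ⟨
        σ b (σ a (σ b x))          ∎
      where
      open ≡-Reasoning
      r₁ = residue-succ-below x e
      r₂ : residue (x + 1ℤ + 1ℤ) ≡ b
      r₂ = trans (residue-suc (x + 1ℤ)) (cong sucF r₁)
    ... | above e = begin
        σ a (σ b (σ a x))          ≡⟨ cong (σ a ∘ σ b) (σ-above a x e) ⟩
        σ a (σ b (x - 1ℤ))         ≡⟨ cong (σ a) (σb-fixes (x - 1ℤ) r₋) ⟩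
        σ a (x - 1ℤ)               ≡⟨ σ-below a (x - 1ℤ) r₋ ⟩
        x - 1ℤ + 1ℤ                ≡⟨ xy∙z≈xz∙y x (- 1ℤ) 1ℤ ⟩
        x + 1ℤ - 1ℤ                ≡⟨ σ-above b (x + 1ℤ) r₊ ⟨
        σ b (x + 1ℤ)               ≡⟨ cong (σ b) (σa-fixes (x + 1ℤ) r₊) ⟨
        σ b (σ a (x + 1ℤ))         ≡⟨ cong (σ b ∘ σ a) (σb-below x e) ⟨
        σ b (σ a (σ b x))          ∎
      where
      open ≡-Reasoning
      r₋ = residue-pred-above x e
      r₊ : residue (x + 1ℤ) ≡ b
      r₊ = trans (residue-suc x) (cong sucF e)
    ... | away ≢predF ≢a with position b x
    ...   | below e = ⊥-elim (≢a (trans e (predF-sucF a)))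
    ...   | above e = begin
        σ a (σ b (σ a x))          ≡⟨ cong (σ a ∘ σ b) (σ-away a x ≢predF ≢a) ⟩
        σ a (σ b x)                ≡⟨ cong (σ a) (σ-above b x e) ⟩
        σ a (x - 1ℤ)               ≡⟨ σ-above a (x - 1ℤ) r₁ ⟩
        x - 1ℤ - 1ℤ                ≡⟨ σb-fixes (x - 1ℤ - 1ℤ) r₂ ⟨
        σ b (x - 1ℤ - 1ℤ)          ≡⟨ cong (σ b) (σ-above a (x - 1ℤ) r₁) ⟨
        σ b (σ a (x - 1ℤ))         ≡⟨ cong (σ b ∘ σ a) (σ-above b x e) ⟨
        σ b (σ a (σ b x))          ∎
      where
      open ≡-Reasoning
      r₁ : residue (x - 1ℤ) ≡ a
      r₁ = trans (residue-pred-above x e) (predF-sucF a)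
      r₂ : residue (x - 1ℤ - 1ℤ) ≡ predF a
      r₂ = residue-pred-above (x - 1ℤ) r₁
    ...   | away ≢predF' ≢b = begin
        σ a (σ b (σ a x))          ≡⟨ cong (σ a ∘ σ b) (σ-away a x ≢predF ≢a) ⟩
        σ a (σ b x)                ≡⟨ cong (σ a) (σ-away b x ≢predF' ≢b) ⟩
        σ a x                      ≡⟨ σ-away a x ≢predF ≢a ⟩
        x                          ≡⟨ σ-away b x ≢predF' ≢b ⟨
        σ b x                      ≡⟨ cong (σ b) (σ-away a x ≢predF ≢a) ⟨
        σ b (σ a x)                ≡⟨ cong (σ b ∘ σ a) (σ-away b x ≢predF' ≢b) ⟨
        σ b (σ a (σ b x))          ∎
      where open ≡-Reasoning

    module _ {f : ℤ → ℤ} (f-periodic : Periodic f) (desc-a : Descent f a) (desc-b : Descent f b) where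
      private
        x₀ x₁ x₂ : ℤ
        x₀ = corner a
        x₁ = x₀ + 1ℤ
        x₂ = x₁ + 1ℤ

        r₀ : residue x₀ ≡ predF a
        r₀ = residue-corner a
        r₁ : residue x₁ ≡ a
        r₁ = residue-succ-below x₀ r₀
        r₁′ : residue x₁ ≡ predF b
        r₁′ = trans r₁ (sym (predF-sucF a))
        r₂ : residue x₂ ≡ b
        r₂ = residue-succ-below x₁ r₁′

        cancel : ∀ x → x + 1ℤ - 1ℤ ≡ x
        cancel = solve-∀

        σa-x₀ : σ a x₀ ≡ x₁
        σa-x₀ = σ-below a x₀ r₀
        σa-x₁ : σ a x₁ ≡ x₀
        σa-x₁ = trans (σ-above a x₁ r₁) (cancel x₀)
        σa-x₂ : σ a x₂ ≡ x₂
        σa-x₂ = σa-fixes x₂ r₂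
        σb-x₀ : σ b x₀ ≡ x₀
        σb-x₀ = σb-fixes x₀ r₀
        σb-x₁ : σ b x₁ ≡ x₂
        σb-x₁ = σb-below x₁ r₁
        σb-x₂ : σ b x₂ ≡ x₁
        σb-x₂ = trans (σ-above b x₂ r₂) (cancel x₁)

        f₁<f₀ : f x₁ ℤ.< f x₀
        f₁<f₀ = desc-a
        f₂<f₁ : f x₂ ℤ.< f x₁
        f₂<f₁ = descent⇒at {f} {b} x₁ f-periodic r₁′ desc-b

      ⋆a-descent-b : Descent (f ⋆ a) b
      ⋆a-descent-b = at⇒descent {f ⋆ a} {b} x₁ (⋆-periodic {f} a f-periodic) r₁′
        (subst₂ ℤ._<_ (cong f (sym σa-x₂)) (cong f (sym σa-x₁)) (ℤP.<-trans f₂<f₁ f₁<f₀))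

      ⋆a⋆b-descent-a : Descent (f ⋆ a ⋆ b) a
      ⋆a⋆b-descent-a = subst₂ ℤ._<_ (cong f (sym (trans (cong (σ a) σb-x₁) σa-x₂))) (cong f (sym (trans (cong (σ a) σb-x₀) σa-x₀))) f₂<f₁

      ⋆b-descent-a : Descent (f ⋆ b) a
      ⋆b-descent-a = subst₂ ℤ._<_ (cong f (sym σb-x₁)) (cong f (sym σb-x₀)) (ℤP.<-trans f₂<f₁ f₁<f₀)

      ⋆b⋆a-descent-b : Descent (f ⋆ b ⋆ a) b
      ⋆b⋆a-descent-b = at⇒descent {f ⋆ b ⋆ a} {b} x₁ (⋆-periodic {f ⋆ b} a (⋆-periodic {f} b f-periodic)) r₁′
        (subst₂ ℤ._<_ (cong f (sym (trans (cong (σ b) σa-x₂) σb-x₂))) (cong f (sym (trans (cong (σ b) σa-x₁) σb-x₀))) f₁<f₀)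

module Canonical (m : ℕ) where
  open import Data.Integer using (_+_; _*_; _-_; -_)
  open Residues m
  open Action m
  open Descents m

  firstDescent : (ℤ → ℤ) → Maybe (Fin n)
  firstDescent f = find (descent? f) (allFin n)

  firstDescent-cong : ∀ {f g} → (∀ x → f x ≡ g x) → firstDescent f ≡ firstDescent g
  firstDescent-cong {f} {g} f≗g = find-cong (descent? f) (descent? g)
    (λ i → cong₂ (λ u v → does (u ℤP.<? v)) (f≗g (corner i + 1ℤ)) (f≗g (corner i))) (allFin n)

  strip : ℕ → (ℤ → ℤ) → Word n
  strip zero f = []
  strip (suc k) f = maybe (λ i → strip k (f ⋆ i) ∷ʳ i) [] (firstDescent f)

  canon : (ℤ → ℤ) → Word n
  canon f = strip (suc (energy f)) f

  strip-cong : ∀ k {f g} → (∀ x → f x ≡ g x) → strip k f ≡ strip k g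
  strip-cong zero f≗g = refl
  strip-cong (suc k) {f} {g} f≗g rewrite firstDescent-cong f≗g with firstDescent g
  ... | nothing = refl
  ... | just i = cong (_∷ʳ i) (strip-cong k (f≗g ∘ σ i))

  energy-cong : ∀ {f g} → (∀ x → f x ≡ g x) → energy f ≡ energy g
  energy-cong f≗g = sum-cong-≗ {n} (λ c → cong (λ z → sq (z - + toℕ c)) (f≗g (+ toℕ c)))

  canon-cong : ∀ {f g} → (∀ x → f x ≡ g x) → canon f ≡ canon g
  canon-cong {f} {g} f≗g = trans (cong (λ e → strip (suc e) f) (energy-cong {f} {g} f≗g)) (strip-cong (suc (energy g)) f≗g)

  strip-fuel : ∀ a b {f} → Periodic f → energy f ℕ.< a → energy f ℕ.< b → strip a f ≡ strip b f
  strip-fuel (suc a) (suc b) {f} f-periodic e<a e<b with firstDescent f in eq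
  ... | nothing = refl
  ... | just i = cong (_∷ʳ i) (strip-fuel a b (⋆-periodic {f} i f-periodic)
                                (ℕP.<-≤-trans decrease (ℕP.≤-pred e<a)) (ℕP.<-≤-trans decrease (ℕP.≤-pred e<b)))
    where
    decrease = energy-descent {f} {i} f-periodic (find-just {P = Descent f} (descent? f) (allFin n) eq)

  canon-first : ∀ {f i} → Periodic f → firstDescent f ≡ just i → canon f ≡ canon (f ⋆ i) ∷ʳ i
  canon-first {f} {i} f-periodic eq = begin
      strip (suc (energy f)) f                  ≡⟨ cong (maybe (λ i → strip (energy f) (f ⋆ i) ∷ʳ i) []) eq ⟩
      strip (energy f) (f ⋆ i) ∷ʳ i             ≡⟨ cong (_∷ʳ i) (strip-fuel _ _ (⋆-periodic {f} i f-periodic) decrease ℕP.≤-refl) ⟩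
      canon (f ⋆ i) ∷ʳ i                        ∎
    where
    open ≡-Reasoning
    decrease = energy-descent {f} {i} f-periodic (find-just {P = Descent f} (descent? f) (allFin n) eq)

  canon-id : canon id ≡ []
  canon-id = cong (maybe (λ i → strip (energy id) (id ⋆ i) ∷ʳ i) []) (find-none {P = Descent id} (descent? id) no-descent (allFin n))
    where
    no-descent : ∀ i → ¬ Descent id i
    no-descent i desc = ℤP.<-irrefl refl (ℤP.<-≤-trans desc (ℤP.i≤i+j (corner i) 1ℤ))

  ExchangeBelow : ℕ → Set
  ExchangeBelow e = ∀ g → Periodic g → energy g ℕ.< e → ∀ {j} → Descent g j → canon g ≈ canon (g ⋆ j) ∷ʳ j

  exchange-far : ∀ {f a b} → ExchangeBelow (energy f) → Periodic f → a ≢ b → ¬ Adj a b →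
                 Descent f a → Descent f b → canon (f ⋆ a) ∷ʳ a ≈ canon (f ⋆ b) ∷ʳ b
  exchange-far {f} {a} {b} IH f-periodic a≢b a≁b desc-a desc-b = begin
      canon (f ⋆ a) ∷ʳ a               ≈⟨ ≈-∷ʳ-++ b (a ∷ []) (IH (f ⋆ a) (⋆-periodic {f} a f-periodic) (energy-descent {f} f-periodic desc-a) (descent-far {f} b≢a b≁a desc-b)) ⟩
      canon (f ⋆ a ⋆ b) ++ b ∷ a ∷ []  ≡⟨ cong (_++ b ∷ a ∷ []) (canon-cong (λ x → cong f (σ-commute a≢b a≁b x))) ⟩
      canon (f ⋆ b ⋆ a) ++ b ∷ a ∷ []  ≈⟨ ≈-++ˡ (canon (f ⋆ b ⋆ a)) (commute b a b≢a b≁a) ⟩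
      canon (f ⋆ b ⋆ a) ++ a ∷ b ∷ []  ≈⟨ ≈-∷ʳ-++ a (b ∷ []) (IH (f ⋆ b) (⋆-periodic {f} b f-periodic) (energy-descent {f} f-periodic desc-b) (descent-far {f} a≢b a≁b desc-a)) ⟨
      canon (f ⋆ b) ∷ʳ b               ∎
    where
    open SetoidReasoning ≈-setoid
    b≢a = a≢b ∘ sym
    b≁a = a≁b ∘ ⊎-swap

  exchange-adjacent : ∀ {f a} → ExchangeBelow (energy f) → Periodic f →
                      Descent f a → Descent f (sucF a) → canon (f ⋆ a) ∷ʳ a ≈ canon (f ⋆ sucF a) ∷ʳ sucF a
  exchange-adjacent {f} {a} IH f-periodic desc-a desc-b = begin
      canon (f ⋆ a) ∷ʳ a                           ≈⟨ ≈-∷ʳ-++ b (a ∷ []) (IH (f ⋆ a) fa-periodic fa<f (⋆a-descent-b {f} f-periodic desc-a desc-b)) ⟩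
      canon (f ⋆ a ⋆ b) ++ b ∷ a ∷ []              ≈⟨ ≈-∷ʳ-++ a (b ∷ a ∷ []) (IH (f ⋆ a ⋆ b) fab-periodic fab<f (⋆a⋆b-descent-a {f} f-periodic desc-a desc-b)) ⟩
      canon (f ⋆ a ⋆ b ⋆ a) ++ a ∷ b ∷ a ∷ []      ≡⟨ cong (_++ a ∷ b ∷ a ∷ []) (canon-cong (λ x → cong f (σ-braid x))) ⟩
      canon (f ⋆ b ⋆ a ⋆ b) ++ a ∷ b ∷ a ∷ []      ≈⟨ ≈-++ˡ (canon (f ⋆ b ⋆ a ⋆ b)) (braid 3≤n a b (inj₁ refl)) ⟩
      canon (f ⋆ b ⋆ a ⋆ b) ++ b ∷ a ∷ b ∷ []      ≈⟨ ≈-∷ʳ-++ b (a ∷ b ∷ []) (IH (f ⋆ b ⋆ a) fba-periodic fba<f (⋆b⋆a-descent-b {f} f-periodic desc-a desc-b)) ⟨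
      canon (f ⋆ b ⋆ a) ++ a ∷ b ∷ []              ≈⟨ ≈-∷ʳ-++ a (b ∷ []) (IH (f ⋆ b) fb-periodic fb<f (⋆b-descent-a {f} f-periodic desc-a desc-b)) ⟨
      canon (f ⋆ b) ∷ʳ b                           ∎
    where
    open SetoidReasoning ≈-setoid
    b = sucF a
    3≤n = adjacent-descents⇒3≤n {f} {a} f-periodic desc-a desc-b
    open Adjacent a 3≤n
    fa-periodic = ⋆-periodic {f} a f-periodic
    fb-periodic = ⋆-periodic {f} b f-periodic
    fab-periodic = ⋆-periodic {f ⋆ a} b fa-periodic
    fba-periodic = ⋆-periodic {f ⋆ b} a fb-periodic
    fa<f = energy-descent {f} f-periodic desc-a
    fb<f = energy-descent {f} f-periodic desc-b
    fab<f = ℕP.<-trans (energy-descent {f ⋆ a} fa-periodic (⋆a-descent-b {f} f-periodic desc-a desc-b)) fa<f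
    fba<f = ℕP.<-trans (energy-descent {f ⋆ b} fb-periodic (⋆b-descent-a {f} f-periodic desc-a desc-b)) fb<f

  exchange : ∀ bound → ExchangeBelow bound
  exchange (suc bound) f f-periodic e<bound {j} desc-j = by-first-descent (firstDescent f) refl
    where
    IH : ExchangeBelow (energy f)
    IH g g-periodic g<f = exchange bound g g-periodic (ℕP.<-≤-trans g<f (ℕP.≤-pred e<bound))

    last-letter : ∀ {i} → Descent f i → Dec (i ≡ j) → Dec (j ≡ sucF i) → Dec (i ≡ sucF j) →
                  canon (f ⋆ i) ∷ʳ i ≈ canon (f ⋆ j) ∷ʳ j
    last-letter desc-i (yes refl) _ _ = ≈-refl
    last-letter desc-i (no _) (yes refl) _ = exchange-adjacent {f} IH f-periodic desc-i desc-j
    last-letter desc-i (no _) (no _) (yes refl) = ≈-sym (exchange-adjacent {f} IH f-periodic desc-j desc-i)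
    last-letter desc-i (no i≢j) (no j≢sucF) (no i≢sucF) = exchange-far {f} IH f-periodic i≢j [ j≢sucF , i≢sucF ] desc-i desc-j

    by-first-descent : ∀ d → firstDescent f ≡ d → canon f ≈ canon (f ⋆ j) ∷ʳ j
    by-first-descent nothing eq = ⊥-elim (find-nothing {P = Descent f} (descent? f) (allFin n) eq (∈-allFin j) desc-j)
    by-first-descent (just i) eq = ≈-trans (≡⇒≈ (canon-first {f} f-periodic eq))
      (last-letter (find-just {P = Descent f} (descent? f) (allFin n) eq) (i F.≟ j) (j F.≟ sucF i) (i F.≟ sucF j))

  canon-⋆ : ∀ {f} → Periodic f → (∀ {x y} → f x ≡ f y → x ≡ y) → ∀ j → canon (f ⋆ j) ≈ canon f ∷ʳ j
  canon-⋆ {f} f-periodic f-injective j with descent? f j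
  ... | yes desc = ≈-sym (begin
      canon f ∷ʳ j                      ≈⟨ ≈-∷ʳ-++ j (j ∷ []) (exchange (suc (energy f)) f f-periodic ℕP.≤-refl desc) ⟩
      canon (f ⋆ j) ++ j ∷ j ∷ []       ≈⟨ ≈-++ˡ (canon (f ⋆ j)) (involution j) ⟩
      canon (f ⋆ j) ++ []               ≡⟨ ++-identityʳ (canon (f ⋆ j)) ⟩
      canon (f ⋆ j)                     ∎)
    where open SetoidReasoning ≈-setoid
  ... | no ¬desc = begin
      canon (f ⋆ j)                     ≈⟨ exchange (suc (energy (f ⋆ j))) (f ⋆ j) (⋆-periodic {f} j f-periodic) ℕP.≤-refl desc′ ⟩
      canon (f ⋆ j ⋆ j) ∷ʳ j            ≡⟨ cong (_∷ʳ j) (canon-cong (λ x → cong f (σ-involutive j x))) ⟩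
      canon f ∷ʳ j                      ∎
    where
    open SetoidReasoning ≈-setoid
    x₀ = corner j
    x₀≢x₀+1 : x₀ ≢ x₀ + 1ℤ
    x₀≢x₀+1 e = 0≢1 (∙-cancelˡ x₀ 0ℤ 1ℤ (trans (ℤP.+-identityʳ x₀) e))
      where
      0≢1 : 0ℤ ≢ 1ℤ
      0≢1 ()
    ascent : f x₀ ℤ.< f (x₀ + 1ℤ)
    ascent = ℤP.≤∧≢⇒< (ℤP.≮⇒≥ ¬desc) (x₀≢x₀+1 ∘ f-injective)
    desc′ : Descent (f ⋆ j) j
    desc′ = subst₂ ℤ._<_
      (cong f (sym (trans (σ-above j (x₀ + 1ℤ) (residue-succ-below x₀ (residue-corner j))) (cancel x₀))))
      (cong f (sym (σ-below j x₀ (residue-corner j))))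
      ascent
      where
      cancel : ∀ x → x + 1ℤ - 1ℤ ≡ x
      cancel = solve-∀

  ⟦⟧-injective : ∀ w {x y} → ⟦ w ⟧ x ≡ ⟦ w ⟧ y → x ≡ y
  ⟦⟧-injective [] eq = eq
  ⟦⟧-injective (i ∷ w) {x} {y} eq = ⟦⟧-injective w
    (trans (sym (σ-involutive i (⟦ w ⟧ x))) (trans (cong (σ i) eq) (σ-involutive i (⟦ w ⟧ y))))

  canon-⟦⟧ : ∀ w → canon ⟦ w ⟧ ≈ w
  canon-⟦⟧ w = by-reverse (reverseView w)
    where
    by-reverse : ∀ {w} → Reverse w → canon ⟦ w ⟧ ≈ w
    by-reverse [] = ≡⇒≈ canon-id
    by-reverse (u ∶ u-view ∶ʳ i) = begin
      canon ⟦ u ∷ʳ i ⟧        ≡⟨ canon-cong (⟦⟧-∷ʳ u i) ⟩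
      canon (⟦ u ⟧ ⋆ i)       ≈⟨ canon-⋆ {⟦ u ⟧} (⟦⟧-periodic u) (⟦⟧-injective u) i ⟩
      canon ⟦ u ⟧ ∷ʳ i        ≈⟨ ≈-++ʳ (i ∷ []) (by-reverse u-view) ⟩
      u ∷ʳ i                  ∎
      where open SetoidReasoning ≈-setoid

  faithful : ∀ {u v} → (∀ x → ⟦ u ⟧ x ≡ ⟦ v ⟧ x) → u ≈ v
  faithful {u} {v} ⟦u⟧≗⟦v⟧ = begin
      u                ≈⟨ canon-⟦⟧ u ⟨
      canon ⟦ u ⟧      ≡⟨ canon-cong ⟦u⟧≗⟦v⟧ ⟩
      canon ⟦ v ⟧      ≈⟨ canon-⟦⟧ v ⟩
      v                ∎
    where open SetoidReasoning ≈-setoid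

lemma2p1 : ∀ (n : ℕ) → 2 ≤ n → ∀ (g₁ g₂ : Word n) (k₁ k₂ : ℕ)
           → IsGlide g₁ k₁ → IsGlide g₂ k₂
           → (g₂ ++ g₁) ≈ (ρ^ k₂ g₁ ++ ρ^- k₁ g₂)
lemma2p1 (suc (suc m)) _ g₁ g₂ k₁ k₂ glide₁ glide₂ =
  Canonical.faithful m (Action.⟦⟧-glide-exchange m g₁ g₂ k₁ k₂ glide₁ glide₂)
lemma2p1 (suc zero) (s≤s ())
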